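{- Let $r\ge1$, $k_1,\dots,k_r\in\mathbb{Z}$, $a$ a complex number that is not an integer $\le r-1$, and $n\ge0$. Then $$B_{n,a}^{(k_1,\ldots,k_r)}(x)=\sum_{0\le m_1\le m_2\le\cdots\le m_r\le n}\frac{m_r!\,W_{ -1,xr}(n,m_r)}{(m_1+a-r+1)^{k_1}(m_2+a-r+2)^{k_2}\cdots(m_r+a)^{k_r}}.$$
   Context: For a positive integer $r$, integers $k_1,\dots,k_r$ and $a$ as stated, the Hurwitz-Lerch multiple zeta function is the formal power series $$\Phi_{(k_1,\ldots,k_r)}(z,a)=\sum_{0\le m_1\le m_2\le\cdots\le m_r}\frac{z^{m_r}}{(m_1+a-r+1)^{k_1}(m_2+a-r+2)^{k_2}\cdots(m_r+a)^{k_r}},$$ and the Hurwitz-Lerch type multi poly-Bernoulli polynomials are defined by $\Phi_{(k_1,\ldots,k_r)}(1-e^{ -t},a)\,e^{rxt}=\sum_{n\ge0}B_{n,a}^{(k_1,\ldots,k_r)}(x)\frac{t^n}{n!}$. The $r$-Whitney numbers of the second kind $W_{m,\rho}(n,k)$ are defined by $\sum_{n\ge k}W_{m,\rho}(n,k)\frac{z^n}{n!}=\frac{e^{\rho z}}{k!}\left(\frac{e^{mz}-1}{m}\right)^k$ (with $W_{m,\rho}(n,k)=0$ for $n<k$); here $m=-1$ and $\rho=xr$. -}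

module Defs where

open import Level using (Level; _⊔_) renaming (suc to lsuc)
open import Algebra.Bundles using (CommutativeRing)
open import Data.Nat as ℕ using (ℕ; zero; suc; _∸_; _!)
open import Data.Integer as ℤ using (ℤ; +_; -[1+_])
open import Data.Fin using (Fin; toℕ)
import Data.Fin as Fin
open import Data.Vec using (Vec; []; _∷_; _∷ʳ_; lookup)
open import Data.List using (List; []; _∷_; map; concatMap; upTo; foldr; filter)
open import Relation.Nullary using (¬_)
open import Relation.Binary.PropositionalEquality using (_≡_)

embℕ : ∀ {c ℓ} (R : CommutativeRing c ℓ) → ℕ → CommutativeRing.Carrier R
embℕ R zero = CommutativeRing.0# R
embℕ R (suc n) = CommutativeRing._+_ R (CommutativeRing.1# R) (embℕ R n)

record Field (c ℓ : Level) : Set (lsuc (c ⊔ ℓ)) where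
  field
    commutativeRing : CommutativeRing c ℓ
  open CommutativeRing commutativeRing public
  field
    _⁻¹ : Carrier → Carrier
    ⁻¹-inverseʳ : ∀ x → ¬ (x ≈ 0#) → x * (x ⁻¹) ≈ 1#
    char0 : ∀ n → ¬ (embℕ commutativeRing (suc n) ≈ 0#)

module FPS {c ℓ} (F : Field c ℓ) where
  open Field F

  ι : ℕ → Carrier
  ι = embℕ commutativeRing

  ιℤ : ℤ → Carrier
  ιℤ (+ n) = ι n
  ιℤ -[1+ n ] = - ι (suc n)

  _^ℕ_ : Carrier → ℕ → Carrier
  x ^ℕ zero = 1#
  x ^ℕ suc n = x * (x ^ℕ n)

  _^ℤ_ : Carrier → ℤ → Carrier
  x ^ℤ (+ n) = x ^ℕ n
  x ^ℤ -[1+ n ] = (x ⁻¹) ^ℕ (suc n)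

  sumTo : ℕ → (ℕ → Carrier) → Carrier
  sumTo zero f = 0#
  sumTo (suc n) f = sumTo n f + f n

  prodFin : (n : ℕ) → (Fin n → Carrier) → Carrier
  prodFin zero f = 1#
  prodFin (suc n) f = f Fin.zero * prodFin n (λ i → f (Fin.suc i))

  sumList : List Carrier → Carrier
  sumList = foldr _+_ 0#

  -- formal power series in one variable: coefficient sequences
  PS : Set c
  PS = ℕ → Carrier

  δ : PS
  δ zero = 1#
  δ (suc n) = 0#

  _⊛_ : PS → PS → PS
  (f ⊛ g) n = sumTo (suc n) (λ i → f i * g (n ∸ i))

  powS : PS → ℕ → PS
  powS g zero = δ
  powS g (suc N) = g ⊛ powS g N

  -- composition f(g(t)) for g with zero constant term:
  -- [t^n] f(g) = Σ_{N ≤ n} f_N [t^n] g^N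
  compose : PS → PS → PS
  compose f g n = sumTo (suc n) (λ N → f N * powS g N n)

  invFact : ℕ → Carrier
  invFact n = (ι (n !)) ⁻¹

  expS : Carrier → PS
  expS x n = (x ^ℕ n) * invFact n

  oneMinusExpNeg : PS
  oneMinusExpNeg n = δ n + - expS (- 1#) n

  -- all weakly increasing vectors (m₁ ≤ … ≤ m_r) with entries ≤ b
  incVecs : (r : ℕ) → ℕ → List (Vec ℕ r)
  incVecs zero b = [] ∷ []
  incVecs (suc r) b = concatMap (λ j → map (_∷ʳ j) (incVecs r j)) (upTo (suc b))

  -- last entry m_r (0 for the empty vector; only used with r ≥ 1)
  top : ∀ {r} → Vec ℕ r → ℕ
  top [] = 0
  top (m ∷ []) = m
  top (m ∷ m' ∷ ms) = top (m' ∷ ms)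

  -- denominator (m₁+a-r+1)^{k₁} ⋯ (m_r+a)^{k_r}
  denom : (r : ℕ) → Vec ℤ r → Carrier → Vec ℕ r → Carrier
  denom r k a m = prodFin r (λ i →
    (((ι (lookup m i) + a) + - ι r) + ι (suc (toℕ i))) ^ℤ lookup k i)

  -- Hurwitz-Lerch multiple zeta function Φ_{(k₁,…,k_r)}(z,a) as a power series in z:
  -- coefficient of z^N is the sum over 0 ≤ m₁ ≤ … ≤ m_r with m_r = N
  Phi : (r : ℕ) → Vec ℤ r → Carrier → PS
  Phi r k a N = sumList (map (λ m → (denom r k a m) ⁻¹)
                  (filter (λ m → top m ℕ.≟ N) (incVecs r N)))

  -- Hurwitz-Lerch type multi poly-Bernoulli polynomial B_{n,a}^{(k)}(x):
  -- n! [t^n] Φ(1 - e^{-t}, a) e^{r x t}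
  B : (r : ℕ) → Vec ℤ r → Carrier → Carrier → ℕ → Carrier
  B r k a x n = ι (n !) * ((compose (Phi r k a) oneMinusExpNeg ⊛ expS (ι r * x)) n)

  -- r-Whitney numbers of the second kind W_{m,ρ}(n,k):
  -- n! [z^n] e^{ρz}/k! ((e^{mz}-1)/m)^k
  W : Carrier → Carrier → ℕ → ℕ → Carrier
  W μ ρ n k = ι (n !) * (((expS ρ ⊛ powS h k) n) * invFact k)
    where
    h : PS
    h j = (expS μ j + - δ j) * (μ ⁻¹)

  RHS : (r : ℕ) → Vec ℤ r → Carrier → Carrier → ℕ → Carrier
  RHS r k a x n = sumList (map (λ m →
      (ι (top m !) * W (- 1#) (x * ι r) n (top m)) * (denom r k a m) ⁻¹)
    (incVecs r n))

module Submission where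

-- Write g = 1 - e^{-t}, E = e^{r x t} and Φ_N for the coefficient of z^N in
-- Φ_{(k)}(z,a).  Since g has no constant term, g^N starts in degree N, so
--   n! [t^n] Φ(g) E  =  Σ_{N ≤ n} Φ_N · n! [t^n] g^N E.
-- On the other hand (e^{-z} - 1)/(-1) = g, so the definition of the
-- r-Whitney numbers gives  N! W_{-1,xr}(n,N) = n! [t^n] g^N E.  Finally Φ_N is
-- the sum of 1/denom(m) over the increasing tuples m with last entry N, and
-- grouping the increasing tuples with entries ≤ n by their last entry turns
-- Σ_{N ≤ n} Φ_N · N! W(n,N) into the right-hand side.

open import Defs
open import Data.Nat using (ℕ; _≤_)
open import Data.Integer as ℤ using (ℤ)
open import Data.Vec using (Vec)
open import Relation.Nullary using (¬_)

open import Data.Nat as ℕ using (zero; suc; _∸_; _<_; _!; z≤n; s≤s)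
import Data.Nat.Properties as ℕP
open import Data.Bool using (true; false; if_then_else_)
open import Data.Sum using (inj₁; inj₂)
open import Data.Vec using ([]; _∷_; _∷ʳ_)
open import Data.List using (List; []; _∷_; map; _++_; concatMap; applyUpTo; upTo; filter)
open import Relation.Nullary using (Dec; does)
open import Relation.Nullary.Decidable using (dec-true; dec-false)
open import Relation.Unary using (Pred; Decidable)
open import Relation.Binary.PropositionalEquality as P using (_≡_; _≢_)
import Algebra.Properties.Ring as RingProperties
import Algebra.Properties.CommutativeSemigroup as CommutativeSemigroupProperties

module Proof {c ℓ} (F : Field c ℓ) where
  open Field F
  open FPS F
  open RingProperties ring using (-1*x≈-x; -‿involutive; -0#≈0#; ⁻¹-anti-homo‿-)
  open CommutativeSemigroupProperties +-commutativeSemigroup using (interchange)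
  open CommutativeSemigroupProperties *-commutativeSemigroup using (x∙yz≈y∙xz)
  open import Relation.Binary.Reasoning.Setoid setoid

  ≡⇒≈ : ∀ {u v} → u ≡ v → u ≈ v
  ≡⇒≈ P.refl = refl

  sumTo-cong : ∀ n {f f' : ℕ → Carrier} → (∀ i → i < n → f i ≈ f' i) →
    sumTo n f ≈ sumTo n f'
  sumTo-cong zero eq = refl
  sumTo-cong (suc n) eq =
    +-cong (sumTo-cong n (λ i i<n → eq i (ℕP.m<n⇒m<1+n i<n))) (eq n (ℕP.n<1+n n))

  sumTo-zero : ∀ n {f : ℕ → Carrier} → (∀ i → i < n → f i ≈ 0#) → sumTo n f ≈ 0#
  sumTo-zero zero vanish = refl
  sumTo-zero (suc n) vanish =
    trans (+-cong (sumTo-zero n (λ i i<n → vanish i (ℕP.m<n⇒m<1+n i<n)))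
                  (vanish n (ℕP.n<1+n n)))
          (+-identityʳ 0#)

  sumTo-+ : ∀ n (f f' : ℕ → Carrier) → sumTo n (λ i → f i + f' i) ≈ sumTo n f + sumTo n f'
  sumTo-+ zero f f' = sym (+-identityʳ 0#)
  sumTo-+ (suc n) f f' = trans (+-cong (sumTo-+ n f f') refl) (interchange _ _ _ _)

  sumTo-*ˡ : ∀ n y (f : ℕ → Carrier) → y * sumTo n f ≈ sumTo n (λ i → y * f i)
  sumTo-*ˡ zero y f = zeroʳ y
  sumTo-*ˡ (suc n) y f = trans (distribˡ y _ _) (+-cong (sumTo-*ˡ n y f) refl)

  sumTo-*ʳ : ∀ n y (f : ℕ → Carrier) → sumTo n f * y ≈ sumTo n (λ i → f i * y)
  sumTo-*ʳ zero y f = zeroˡ y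
  sumTo-*ʳ (suc n) y f = trans (distribʳ y _ _) (+-cong (sumTo-*ʳ n y f) refl)

  sumTo-swap : ∀ m n (f : ℕ → ℕ → Carrier) →
    sumTo m (λ i → sumTo n (λ j → f i j)) ≈ sumTo n (λ j → sumTo m (λ i → f i j))
  sumTo-swap zero n f = sym (sumTo-zero n (λ _ _ → refl))
  sumTo-swap (suc m) n f =
    trans (+-cong (sumTo-swap m n f) refl)
          (sym (sumTo-+ n (λ j → sumTo m (λ i → f i j)) (f m)))

  sumTo-shift : ∀ n (f : ℕ → Carrier) → sumTo (suc n) f ≈ f 0 + sumTo n (λ i → f (suc i))
  sumTo-shift zero f = +-comm 0# (f 0)
  sumTo-shift (suc n) f = trans (+-cong (sumTo-shift n f) refl) (+-assoc _ _ _)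

  sumTo-reverse : ∀ n (f : ℕ → Carrier) → sumTo (suc n) f ≈ sumTo (suc n) (λ i → f (n ∸ i))
  sumTo-reverse zero f = refl
  sumTo-reverse (suc n) f =
    trans (+-comm _ _)
      (trans (+-cong refl (sumTo-reverse n f))
        (sym (sumTo-shift (suc n) (λ i → f (suc n ∸ i)))))

  sumTo-extend : ∀ {f : ℕ → Carrier} i n → i ≤ n → (∀ N → i < N → f N ≈ 0#) →
    sumTo (suc i) f ≈ sumTo (suc n) f
  sumTo-extend i zero z≤n vanish = refl
  sumTo-extend i (suc n) i≤1+n vanish with ℕP.m≤n⇒m<n∨m≡n i≤1+n
  ... | inj₂ P.refl = refl
  ... | inj₁ i<1+n =
    trans (sumTo-extend i n (ℕ.s≤s⁻¹ i<1+n) vanish)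
          (trans (sym (+-identityʳ _)) (+-cong refl (sym (vanish (suc n) i<1+n))))

  ΣL : ∀ {A : Set} → (A → Carrier) → List A → Carrier
  ΣL f xs = sumList (map f xs)

  ΣL-cong : ∀ {A : Set} {f f' : A → Carrier} (xs : List A) → (∀ x → f x ≈ f' x) →
    ΣL f xs ≈ ΣL f' xs
  ΣL-cong [] eq = refl
  ΣL-cong (x ∷ xs) eq = +-cong (eq x) (ΣL-cong xs eq)

  ΣL-*ˡ : ∀ {A : Set} y (f : A → Carrier) (xs : List A) → y * ΣL f xs ≈ ΣL (λ x → y * f x) xs
  ΣL-*ˡ y f [] = zeroʳ y
  ΣL-*ˡ y f (x ∷ xs) = trans (distribˡ y _ _) (+-cong refl (ΣL-*ˡ y f xs))

  ΣL-map : ∀ {A B : Set} (f : B → Carrier) (h : A → B) (xs : List A) →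
    ΣL f (map h xs) ≈ ΣL (λ x → f (h x)) xs
  ΣL-map f h [] = refl
  ΣL-map f h (x ∷ xs) = +-cong refl (ΣL-map f h xs)

  ΣL-++ : ∀ {A : Set} (f : A → Carrier) (xs ys : List A) → ΣL f (xs ++ ys) ≈ ΣL f xs + ΣL f ys
  ΣL-++ f [] ys = sym (+-identityˡ _)
  ΣL-++ f (x ∷ xs) ys = trans (+-cong refl (ΣL-++ f xs ys)) (sym (+-assoc _ _ _))

  ΣL-concatMap : ∀ {A B : Set} (f : B → Carrier) (G : A → List B) (xs : List A) →
    ΣL f (concatMap G xs) ≈ ΣL (λ x → ΣL f (G x)) xs
  ΣL-concatMap f G [] = refl
  ΣL-concatMap f G (x ∷ xs) =
    trans (ΣL-++ f (G x) (concatMap G xs)) (+-cong refl (ΣL-concatMap f G xs))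

  ΣL-applyUpTo : ∀ n (f : ℕ → Carrier) (h : ℕ → ℕ) → ΣL f (applyUpTo h n) ≈ sumTo n (λ i → f (h i))
  ΣL-applyUpTo zero f h = refl
  ΣL-applyUpTo (suc n) f h =
    trans (+-cong refl (ΣL-applyUpTo n f (λ i → h (suc i))))
          (sym (sumTo-shift n (λ i → f (h i))))

  ΣL-filter : ∀ {A : Set} {p} {Q : Pred A p} (Q? : Decidable Q) (f : A → Carrier) (xs : List A) →
    ΣL f (filter Q? xs) ≈ ΣL (λ x → if does (Q? x) then f x else 0#) xs
  ΣL-filter Q? f [] = refl
  ΣL-filter Q? f (x ∷ xs) with does (Q? x)
  ... | true = +-cong refl (ΣL-filter Q? f xs)
  ... | false = trans (ΣL-filter Q? f xs) (sym (+-identityˡ _))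

  top-∷ʳ : ∀ {r} (v : Vec ℕ r) j → top (v ∷ʳ j) ≡ j
  top-∷ʳ [] j = P.refl
  top-∷ʳ (_ ∷ []) j = P.refl
  top-∷ʳ (_ ∷ w ∷ v) j = top-∷ʳ (w ∷ v) j

  incVecs-by-top : ∀ r n (f : Vec ℕ (suc r) → Carrier) →
    ΣL f (incVecs (suc r) n) ≈ sumTo (suc n) (λ j → ΣL (λ v → f (v ∷ʳ j)) (incVecs r j))
  incVecs-by-top r n f = begin
    ΣL f (concatMap slice (upTo (suc n)))           ≈⟨ ΣL-concatMap f slice (upTo (suc n)) ⟩
    ΣL (λ j → ΣL f (slice j)) (upTo (suc n))        ≈⟨ ΣL-applyUpTo (suc n) _ (λ j → j) ⟩
    sumTo (suc n) (λ j → ΣL f (slice j))            ≈⟨ sumTo-cong (suc n) (λ j _ → ΣL-map f (_∷ʳ j) (incVecs r j)) ⟩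
    sumTo (suc n) (λ j → ΣL (λ v → f (v ∷ʳ j)) (incVecs r j)) ∎
    where
    slice : ℕ → List (Vec ℕ (suc r))
    slice j = map (_∷ʳ j) (incVecs r j)

  Phi-coefficient : ∀ r (k : Vec ℤ (suc r)) a N →
    Phi (suc r) k a N ≈ ΣL (λ v → denom (suc r) k a (v ∷ʳ N) ⁻¹) (incVecs r N)
  Phi-coefficient r k a N = begin
    ΣL d (filter endsIn? (incVecs (suc r) N))          ≈⟨ ΣL-filter endsIn? d (incVecs (suc r) N) ⟩
    ΣL cut (incVecs (suc r) N)                         ≈⟨ incVecs-by-top r N cut ⟩
    sumTo N cutAt + cutAt N
      ≈⟨ +-cong (sumTo-zero N (λ j j<N → ΣL-zero j (ℕP.<⇒≢ j<N) (incVecs r j)))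
                (ΣL-cong (incVecs r N) kept) ⟩
    0# + ΣL (λ v → d (v ∷ʳ N)) (incVecs r N)           ≈⟨ +-identityˡ _ ⟩
    ΣL (λ v → d (v ∷ʳ N)) (incVecs r N)                ∎
    where
    d : Vec ℕ (suc r) → Carrier
    d m = denom (suc r) k a m ⁻¹
    endsIn? : (m : Vec ℕ (suc r)) → Dec (top m ≡ N)
    endsIn? m = top m ℕ.≟ N
    cut : Vec ℕ (suc r) → Carrier
    cut m = if does (endsIn? m) then d m else 0#
    cutAt : ℕ → Carrier
    cutAt j = ΣL (λ v → cut (v ∷ʳ j)) (incVecs r j)
    kept : ∀ v → cut (v ∷ʳ N) ≈ d (v ∷ʳ N)
    kept v rewrite dec-true (endsIn? (v ∷ʳ N)) (top-∷ʳ v N) = refl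
    dropped : ∀ j → j ≢ N → ∀ v → cut (v ∷ʳ j) ≈ 0#
    dropped j j≢N v rewrite dec-false (endsIn? (v ∷ʳ j)) (λ e → j≢N (P.trans (P.sym (top-∷ʳ v j)) e)) = refl
    ΣL-zero : ∀ j → j ≢ N → (vs : List (Vec ℕ r)) → ΣL (λ v → cut (v ∷ʳ j)) vs ≈ 0#
    ΣL-zero j j≢N [] = refl
    ΣL-zero j j≢N (v ∷ vs) = trans (+-cong (dropped j j≢N v) (ΣL-zero j j≢N vs)) (+-identityʳ 0#)

  self-inverse : ∀ y → ¬ (y ≈ 0#) → y * y ≈ 1# → y ⁻¹ ≈ y
  self-inverse y y≉0 y²≈1 = begin
    y ⁻¹             ≈⟨ sym (*-identityˡ _) ⟩
    1# * y ⁻¹        ≈⟨ *-cong (sym y²≈1) refl ⟩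
    (y * y) * y ⁻¹   ≈⟨ *-assoc y y (y ⁻¹) ⟩
    y * (y * y ⁻¹)   ≈⟨ *-cong refl (⁻¹-inverseʳ y y≉0) ⟩
    y * 1#           ≈⟨ *-identityʳ y ⟩
    y                ∎

  -1≉0 : ¬ (- 1# ≈ 0#)
  -1≉0 -1≈0 = char0 0 (trans (+-identityʳ 1#)
                        (trans (sym (-‿involutive 1#)) (trans (-‿cong -1≈0) -0#≈0#)))

  -1⁻¹≈-1 : (- 1#) ⁻¹ ≈ - 1#
  -1⁻¹≈-1 = self-inverse (- 1#) -1≉0 (trans (-1*x≈-x (- 1#)) (-‿involutive 1#))

  factorial-cancel : ∀ m y → ι (m !) * (y * invFact m) ≈ y
  factorial-cancel m y = begin
    ι (m !) * (y * invFact m)  ≈⟨ x∙yz≈y∙xz _ _ _ ⟩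
    y * (ι (m !) * invFact m)  ≈⟨ *-cong refl (nonzero-inverse (m !) (ℕP.1≤n! m)) ⟩
    y * 1#                     ≈⟨ *-identityʳ y ⟩
    y                          ∎
    where
    nonzero-inverse : ∀ j → 1 ≤ j → ι j * ι j ⁻¹ ≈ 1#
    nonzero-inverse (suc j) _ = ⁻¹-inverseʳ _ (char0 j)

  expS-zero : ∀ y → expS y 0 ≈ 1#
  expS-zero y = trans (*-cong (sym (+-identityʳ 1#)) refl) (⁻¹-inverseʳ _ (char0 0))

  expS-cong : ∀ {y y'} → y ≈ y' → ∀ i → expS y i ≈ expS y' i
  expS-cong {y} {y'} y≈y' i = *-cong (pow-cong i) refl
    where
    pow-cong : ∀ j → y ^ℕ j ≈ y' ^ℕ j
    pow-cong zero = refl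
    pow-cong (suc j) = *-cong y≈y' (pow-cong j)

  ⊛-comm : ∀ (f h : PS) n → (f ⊛ h) n ≈ (h ⊛ f) n
  ⊛-comm f h n =
    trans (sumTo-reverse n (λ i → f i * h (n ∸ i)))
          (sumTo-cong (suc n) (λ i i≤n →
            trans (*-comm _ _) (*-cong (≡⇒≈ (P.cong h (ℕP.m∸[m∸n]≡n (ℕ.s≤s⁻¹ i≤n)))) refl)))

  powS-cong : ∀ {h h' : PS} → (∀ j → h j ≈ h' j) → ∀ N i → powS h N i ≈ powS h' N i
  powS-cong eq zero i = refl
  powS-cong eq (suc N) i = sumTo-cong (suc i) (λ j _ → *-cong (eq j) (powS-cong eq N (i ∸ j)))

  powS-vanishes-below : ∀ {h : PS} → h 0 ≈ 0# → ∀ N i → i < N → powS h N i ≈ 0#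
  powS-vanishes-below {h} h0≈0 (suc N) i i≤N = sumTo-zero (suc i) term
    where
    term : ∀ j → j < suc i → h j * powS h N (i ∸ j) ≈ 0#
    term zero _ = trans (*-cong h0≈0 refl) (zeroˡ _)
    term (suc j) j<i = trans (*-cong refl (powS-vanishes-below h0≈0 N (i ∸ suc j) i-j<N)) (zeroʳ _)
      where
      i-j<N : i ∸ suc j < N
      i-j<N = ℕP.<-≤-trans (ℕP.∸-monoʳ-< {i} {suc j} {0} (s≤s z≤n) (ℕ.s≤s⁻¹ j<i)) (ℕ.s≤s⁻¹ i≤N)

  compose-⊛ : ∀ (f h E : PS) → h 0 ≈ 0# → ∀ n →
    (compose f h ⊛ E) n ≈ sumTo (suc n) (λ N → f N * (powS h N ⊛ E) n)
  compose-⊛ f h E h0≈0 n = begin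
    sumTo (suc n) (λ i → compose f h i * E (n ∸ i))
      ≈⟨ sumTo-cong (suc n) (λ i i≤n → *-cong (sumTo-extend i n (ℕ.s≤s⁻¹ i≤n) (high-powers i)) refl) ⟩
    sumTo (suc n) (λ i → sumTo (suc n) (λ N → f N * powS h N i) * E (n ∸ i))
      ≈⟨ sumTo-cong (suc n) (λ i _ → trans (sumTo-*ʳ (suc n) (E (n ∸ i)) _)
                                            (sumTo-cong (suc n) (λ N _ → *-assoc _ _ _))) ⟩
    sumTo (suc n) (λ i → sumTo (suc n) (λ N → f N * (powS h N i * E (n ∸ i))))
      ≈⟨ sumTo-swap (suc n) (suc n) _ ⟩
    sumTo (suc n) (λ N → sumTo (suc n) (λ i → f N * (powS h N i * E (n ∸ i))))
      ≈⟨ sumTo-cong (suc n) (λ N _ → sym (sumTo-*ˡ (suc n) (f N) _)) ⟩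
    sumTo (suc n) (λ N → f N * (powS h N ⊛ E) n) ∎
    where
    high-powers : ∀ i N → i < N → f N * powS h N i ≈ 0#
    high-powers i N i<N = trans (*-cong refl (powS-vanishes-below h0≈0 N i i<N)) (zeroʳ _)

  g : PS
  g = oneMinusExpNeg

  g-no-constant-term : g 0 ≈ 0#
  g-no-constant-term = trans (+-cong refl (-‿cong (expS-zero (- 1#)))) (-‿inverseʳ 1#)

  whitneySeries : Carrier → PS
  whitneySeries μ j = (expS μ j + - δ j) * μ ⁻¹

  whitneySeries-minus-one : ∀ j → whitneySeries (- 1#) j ≈ g j
  whitneySeries-minus-one j = begin
    (expS (- 1#) j + - δ j) * (- 1#) ⁻¹  ≈⟨ *-cong refl -1⁻¹≈-1 ⟩
    (expS (- 1#) j + - δ j) * - 1#       ≈⟨ *-comm _ _ ⟩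
    - 1# * (expS (- 1#) j + - δ j)       ≈⟨ -1*x≈-x _ ⟩
    - (expS (- 1#) j + - δ j)            ≈⟨ ⁻¹-anti-homo‿- _ _ ⟩
    δ j + - expS (- 1#) j                ∎

  whitney-coefficient : ∀ ρ n m → ι (m !) * W (- 1#) ρ n m ≈ ι (n !) * (powS g m ⊛ expS ρ) n
  whitney-coefficient ρ n m = begin
    ι (m !) * (ι (n !) * (Y * invFact m))  ≈⟨ x∙yz≈y∙xz _ _ _ ⟩
    ι (n !) * (ι (m !) * (Y * invFact m))  ≈⟨ *-cong refl (factorial-cancel m Y) ⟩
    ι (n !) * Y                            ≈⟨ *-cong refl (⊛-comm (expS ρ) _ n) ⟩
    ι (n !) * (powS (whitneySeries (- 1#)) m ⊛ expS ρ) n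
      ≈⟨ *-cong refl (sumTo-cong (suc n) (λ i _ → *-cong (powS-cong whitneySeries-minus-one m i) refl)) ⟩
    ι (n !) * (powS g m ⊛ expS ρ) n        ∎
    where
    Y : Carrier
    Y = (expS ρ ⊛ powS (whitneySeries (- 1#)) m) n

open Proof

theorem3p1 : ∀ {c ℓ} (F : Field c ℓ) → let open Field F in let open FPS F in
    (r : ℕ) → 1 ≤ r → (k : Vec ℤ r) → (a : Carrier) →
    (∀ (j : ℤ) → j ℤ.≤ ℤ.+ r ℤ.- ℤ.1ℤ → ¬ (a ≈ ιℤ j)) →
    (n : ℕ) → (x : Carrier) →
    B r k a x n ≈ RHS r k a x n
theorem3p1 F zero () k a _ n x
theorem3p1 F (suc r') _ k a _ n x = begin
  ι (n !) * (compose (Phi r k a) (g F) ⊛ E) n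
    ≈⟨ *-cong refl (compose-⊛ F (Phi r k a) (g F) E (g-no-constant-term F) n) ⟩
  ι (n !) * sumTo (suc n) (λ N → Phi r k a N * X N)
    ≈⟨ sumTo-*ˡ F (suc n) _ _ ⟩
  sumTo (suc n) (λ N → ι (n !) * (Phi r k a N * X N))
    ≈⟨ sumTo-cong F (suc n) (λ N _ → terms-ending-in N) ⟩
  sumTo (suc n) (λ N → ΣL F (λ v → term (v ∷ʳ N)) (incVecs r' N))
    ≈⟨ sym (incVecs-by-top F r' n term) ⟩
  ΣL F term (incVecs r n) ∎
  where
  open Field F
  open FPS F
  open CommutativeSemigroupProperties *-commutativeSemigroup using (x∙yz≈y∙xz)
  open import Relation.Binary.Reasoning.Setoid setoid
  r : ℕ
  r = suc r'
  E : PS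
  E = expS (ι r * x)
  X : ℕ → Carrier
  X N = (powS (g F) N ⊛ E) n
  d : Vec ℕ r → Carrier
  d m = denom r k a m ⁻¹
  term : Vec ℕ r → Carrier
  term m = (ι (top m !) * W (- 1#) (x * ι r) n (top m)) * d m
  term-at : ∀ N v → term (v ∷ʳ N) ≈ (ι (n !) * X N) * d (v ∷ʳ N)
  term-at N v rewrite top-∷ʳ F v N = *-cong
    (trans (whitney-coefficient F (x * ι r) n N)
           (*-cong refl (sumTo-cong F (suc n) (λ i _ → *-cong refl (expS-cong F (*-comm x (ι r)) (n ∸ i))))))
    refl
  terms-ending-in : ∀ N → ι (n !) * (Phi r k a N * X N) ≈ ΣL F (λ v → term (v ∷ʳ N)) (incVecs r' N)
  terms-ending-in N = begin
    ι (n !) * (Phi r k a N * X N)                          ≈⟨ x∙yz≈y∙xz _ _ _ ⟩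
    Phi r k a N * (ι (n !) * X N)                          ≈⟨ *-comm _ _ ⟩
    (ι (n !) * X N) * Phi r k a N                          ≈⟨ *-cong refl (Phi-coefficient F r' k a N) ⟩
    (ι (n !) * X N) * ΣL F (λ v → d (v ∷ʳ N)) (incVecs r' N) ≈⟨ ΣL-*ˡ F _ _ (incVecs r' N) ⟩
    ΣL F (λ v → (ι (n !) * X N) * d (v ∷ʳ N)) (incVecs r' N) ≈⟨ ΣL-cong F (incVecs r' N) (λ v → sym (term-at N v)) ⟩
    ΣL F (λ v → term (v ∷ʳ N)) (incVecs r' N)              ∎
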